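{- Let $(a,g,f)$ be an almost-Riordan array with associated matrix $M$, and let $P=M^{ -1}\overline{M}$ be its production matrix, where $\overline{M}$ is $M$ with its top row removed. Then: the first (index $0$) column of $P$ is the coefficient sequence of $(a,g,f)^{ -1}\cdot\tilde a(x)$; the second (index $1$) column of $P$ is the coefficient sequence of $(a,g,f)^{ -1}\cdot g(x)$; and for every $k\ge 2$, column $k$ of $P$ is the $A$-sequence of the Riordan array $(g,f)$ placed starting at row $k-1$, i.e. $P_{n,k}=A_{n-k+1}$ (with $A_j=0$ for $j<0$), where $A(x)=\sum_j A_jx^j=\frac{x}{\bar f(x)}$.
   Context: All power series have integer coefficients. For a power series $h(x)=\sum h_nx^n$ write $\tilde h(x)=(h(x)-h_0)/x$. For $f$ with $f_0=0$, $f_1=1$, $\bar f$ denotes its series reversion ($\bar f(0)=0$, $f(\bar f(x))=x$). An almost-Riordan array is an ordered triple $(a,g,f)$ of power series with $a_0=1$, $g_0=1$, $f_0=0$, $f_1=1$, identified with the infinite lower-triangular matrix $M$ given by $M_{n,0}=a_n$, $M_{0,k}=0$ for $k\ge1$, $M_{n,k}=[x^{n-1}]g(x)f(x)^{k-1}$ for $n,k\ge1$. For a power series $h$, $(a,g,f)\cdot h$ is the power series whose coefficient sequence is $M(h_0,h_1,\dots)^T$, and $(a,g,f)^{ -1}\cdot h$ similarly uses the inverse matrix $M^{ -1}$ (which is again the matrix of an almost-Riordan array). The Riordan array $(g,f)$ is the lower-triangular matrix with $(n,k)$ entry $[x^n]g(x)f(x)^k$; its $A$-sequence has generating function $A(x)=x/\bar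 f(x)$. -}

module Defs where

open import Data.Nat using (ℕ; zero; suc; _≤_; _∸_; _≤?_)
open import Data.Integer using (ℤ; 0ℤ; 1ℤ; _+_; _*_)
open import Relation.Binary.PropositionalEquality using (_≡_)
open import Relation.Nullary using (yes; no)

Series : Set
Series = ℕ → ℤ

-- Infinite matrices (row index, column index).
Matrix : Set
Matrix = ℕ → ℕ → ℤ

sumTo : ℕ → (ℕ → ℤ) → ℤ
sumTo zero    h = h 0
sumTo (suc n) h = sumTo n h + h (suc n)

_≈_ : Series → Series → Set
f ≈ g = ∀ n → f n ≡ g n

X : Series
X zero          = 0ℤ
X (suc zero)    = 1ℤ
X (suc (suc _)) = 0ℤ

One : Series
One zero    = 1ℤ
One (suc _) = 0ℤ

_⊛_ : Series → Series → Series
(f ⊛ g) n = sumTo n (λ i → f i * g (n ∸ i))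

_^^_ : Series → ℕ → Series
f ^^ zero  = One
f ^^ suc k = f ⊛ (f ^^ k)

-- Composition f(h(x)) (meaningful when h 0 = 0): [x^n] = Σ_{k≤n} f_k [x^n] h^k.
compose : Series → Series → Series
compose f h n = sumTo n (λ k → f k * (h ^^ k) n)

-- h̃(x) = (h(x) - h_0)/x
tilde : Series → Series
tilde h n = h (suc n)

record AlmostRiordan : Set where
  field
    a g f : Series
    a0 : a 0 ≡ 1ℤ
    g0 : g 0 ≡ 1ℤ
    f0 : f 0 ≡ 0ℤ
    f1 : f 1 ≡ 1ℤ

matrixOf : AlmostRiordan → Matrix
matrixOf R n zero          = AlmostRiordan.a R n
matrixOf R zero (suc k)    = 0ℤ
matrixOf R (suc n) (suc k) = (AlmostRiordan.g R ⊛ (AlmostRiordan.f R ^^ k)) n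

LowerTriangular : Matrix → Set
LowerTriangular N = ∀ n k → n Data.Nat.< k → N n k ≡ 0ℤ

-- Product of a lower-triangular matrix L with a matrix B:
-- (L B)_{n,k} = Σ_{j ≤ n} L_{n,j} B_{j,k}  (exact since L_{n,j} = 0 for j > n).
_⊙_ : Matrix → Matrix → Matrix
(L ⊙ B) n k = sumTo n (λ j → L n j * B j k)

Identity : Matrix
Identity n k with n Data.Nat.≟ k
... | yes _ = 1ℤ
... | no  _ = 0ℤ

IsInverse : Matrix → Matrix → Set
IsInverse N M = LowerTriangular N × (∀ n k → (N ⊙ M) n k ≡ Identity n k)
                                 × (∀ n k → (M ⊙ N) n k ≡ Identity n k)
  where open import Data.Product using (_×_)

dropTop : Matrix → Matrix
dropTop M n k = M (suc n) k

apply : Matrix → Series → Series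
apply L h n = sumTo n (λ j → L n j * h j)

placedFrom : ℕ → Series → Series
placedFrom r A n with r ≤? n
... | yes _ = A (n ∸ r)
... | no  _ = 0ℤ

-- The whole argument rests on the functional equation f = x · A(f), obtained by
-- composing both sides on the right with f̄, which is injective since f̄ = x + O(x²):
-- the left becomes x by definition of f̄, the right becomes f̄ · A = x by definition
-- of A. Multiplying out, [x^(j+1)] g f^(k-1) = Σ_l A_l [x^j] g f^(k-2+l), i.e. column k
-- of M̄ is M applied to the A-sequence placed from row k-1, which M⁻¹ recovers.
-- Columns 0 and 1 of M̄ are ã and g themselves, so there M⁻¹ is simply applied.
module Submission where

open import Defs
open import Data.Nat using (ℕ; zero; suc; _∸_; z≤n; s≤s; _≟_; _≤?_)
  renaming (_+_ to _+ℕ_; _≤_ to _≤ℕ_; _<_ to _<ℕ_)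
import Data.Nat.Properties as ℕ
open import Data.Integer using (ℤ; 0ℤ; 1ℤ; _+_; _*_)
import Data.Integer.Properties as ℤ
open import Algebra.Properties.CommutativeSemigroup ℤ.+-commutativeSemigroup
  using () renaming (interchange to +-interchange)
open import Algebra.Properties.CommutativeSemigroup ℤ.*-commutativeSemigroup
  using (x∙yz≈y∙xz) renaming (interchange to *-interchange)
open import Algebra.Properties.AbelianGroup ℤ.+-0-abelianGroup
  using () renaming (∙-cancelˡ to +-cancelˡ)
open import Data.Product using (_×_; _,_)
open import Data.Sum using (inj₁; inj₂)
open import Data.Empty using (⊥-elim)
open import Relation.Nullary using (yes; no; ¬_)
open import Relation.Binary.PropositionalEquality
open ≡-Reasoning

sumTo-cong-≤ : ∀ n {f g : ℕ → ℤ} → (∀ i → i ≤ℕ n → f i ≡ g i) → sumTo n f ≡ sumTo n g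
sumTo-cong-≤ zero    eq = eq 0 z≤n
sumTo-cong-≤ (suc n) eq =
  cong₂ _+_ (sumTo-cong-≤ n (λ i i≤n → eq i (ℕ.m≤n⇒m≤1+n i≤n))) (eq (suc n) ℕ.≤-refl)

sumTo-cong : ∀ n {f g : ℕ → ℤ} → (∀ i → f i ≡ g i) → sumTo n f ≡ sumTo n g
sumTo-cong n eq = sumTo-cong-≤ n (λ i _ → eq i)

sumTo-≡0 : ∀ n {f : ℕ → ℤ} → (∀ i → i ≤ℕ n → f i ≡ 0ℤ) → sumTo n f ≡ 0ℤ
sumTo-≡0 zero    eq = eq 0 z≤n
sumTo-≡0 (suc n) eq =
  cong₂ _+_ (sumTo-≡0 n (λ i i≤n → eq i (ℕ.m≤n⇒m≤1+n i≤n))) (eq (suc n) ℕ.≤-refl)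

sumTo-+ : ∀ n (f g : ℕ → ℤ) → sumTo n (λ i → f i + g i) ≡ sumTo n f + sumTo n g
sumTo-+ zero    f g = refl
sumTo-+ (suc n) f g = begin
  sumTo n (λ i → f i + g i) + (f (suc n) + g (suc n))
    ≡⟨ cong (_+ (f (suc n) + g (suc n))) (sumTo-+ n f g) ⟩
  (sumTo n f + sumTo n g) + (f (suc n) + g (suc n))
    ≡⟨ +-interchange (sumTo n f) (sumTo n g) (f (suc n)) (g (suc n)) ⟩
  (sumTo n f + f (suc n)) + (sumTo n g + g (suc n)) ∎

*-distribˡ-sumTo : ∀ n c (f : ℕ → ℤ) → c * sumTo n f ≡ sumTo n (λ i → c * f i)
*-distribˡ-sumTo zero    c f = refl
*-distribˡ-sumTo (suc n) c f =
  trans (ℤ.*-distribˡ-+ c (sumTo n f) (f (suc n))) (cong (_+ c * f (suc n)) (*-distribˡ-sumTo n c f))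

*-distribʳ-sumTo : ∀ n c (f : ℕ → ℤ) → sumTo n f * c ≡ sumTo n (λ i → f i * c)
*-distribʳ-sumTo zero    c f = refl
*-distribʳ-sumTo (suc n) c f =
  trans (ℤ.*-distribʳ-+ c (sumTo n f) (f (suc n))) (cong (_+ f (suc n) * c) (*-distribʳ-sumTo n c f))

sumTo-sucˡ : ∀ n (f : ℕ → ℤ) → sumTo (suc n) f ≡ f 0 + sumTo n (λ i → f (suc i))
sumTo-sucˡ zero    f = refl
sumTo-sucˡ (suc n) f = trans (cong (_+ f (suc (suc n))) (sumTo-sucˡ n f))
  (ℤ.+-assoc (f 0) (sumTo n (λ i → f (suc i))) (f (suc (suc n))))

sumTo-comm : ∀ n m (F : ℕ → ℕ → ℤ) →
  sumTo n (λ i → sumTo m (λ j → F i j)) ≡ sumTo m (λ j → sumTo n (λ i → F i j))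
sumTo-comm zero    m F = refl
sumTo-comm (suc n) m F = begin
  sumTo n (λ i → sumTo m (F i)) + sumTo m (F (suc n))
    ≡⟨ cong (_+ sumTo m (F (suc n))) (sumTo-comm n m F) ⟩
  sumTo m (λ j → sumTo n (λ i → F i j)) + sumTo m (F (suc n))
    ≡⟨ sumTo-+ m (λ j → sumTo n (λ i → F i j)) (F (suc n)) ⟨
  sumTo m (λ j → sumTo n (λ i → F i j) + F (suc n) j) ∎

sumTo-truncate : ∀ m n {f : ℕ → ℤ} → m ≤ℕ n → (∀ i → m <ℕ i → i ≤ℕ n → f i ≡ 0ℤ) →
  sumTo n f ≡ sumTo m f
sumTo-truncate m zero    z≤n  _  = refl
sumTo-truncate m (suc n) m≤1+n eq with ℕ.m≤n⇒m<n∨m≡n m≤1+n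
... | inj₂ refl = refl
... | inj₁ m<1+n = trans
  (cong₂ _+_ (sumTo-truncate m n (ℕ.≤-pred m<1+n) (λ i m<i i≤n → eq i m<i (ℕ.m≤n⇒m≤1+n i≤n)))
             (eq (suc n) m<1+n ℕ.≤-refl))
  (ℤ.+-identityʳ _)

sumTo-dropInitial : ∀ m n (f : ℕ → ℤ) → m ≤ℕ n → (∀ i → i <ℕ m → f i ≡ 0ℤ) →
  sumTo n f ≡ sumTo (n ∸ m) (λ l → f (m +ℕ l))
sumTo-dropInitial zero    n       f _         _  = refl
sumTo-dropInitial (suc m) (suc n) f (s≤s m≤n) eq = begin
  sumTo (suc n) f                          ≡⟨ sumTo-sucˡ n f ⟩
  f 0 + sumTo n (λ i → f (suc i))
    ≡⟨ cong₂ _+_ (eq 0 (s≤s z≤n)) (sumTo-dropInitial m n (λ i → f (suc i)) m≤n (λ i i<m → eq (suc i) (s≤s i<m))) ⟩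
  0ℤ + sumTo (n ∸ m) (λ l → f (suc m +ℕ l)) ≡⟨ ℤ.+-identityˡ _ ⟩
  sumTo (n ∸ m) (λ l → f (suc m +ℕ l))     ∎

sumTo-reverse : ∀ n (f : ℕ → ℤ) → sumTo n f ≡ sumTo n (λ i → f (n ∸ i))
sumTo-reverse zero    f = refl
sumTo-reverse (suc n) f = begin
  sumTo n f + f (suc n)                  ≡⟨ ℤ.+-comm (sumTo n f) (f (suc n)) ⟩
  f (suc n) + sumTo n f                  ≡⟨ cong (f (suc n) +_) (sumTo-reverse n f) ⟩
  f (suc n) + sumTo n (λ i → f (n ∸ i))  ≡⟨ sumTo-sucˡ n (λ i → f (suc n ∸ i)) ⟨
  sumTo (suc n) (λ i → f (suc n ∸ i))    ∎

sumTo-triangle : ∀ n (F : ℕ → ℕ → ℤ) →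
  sumTo n (λ m → sumTo m (λ k → F k m)) ≡ sumTo n (λ k → sumTo (n ∸ k) (λ l → F k (k +ℕ l)))
sumTo-triangle zero    F = refl
sumTo-triangle (suc n) F = begin
  L + (S + F (suc n) (suc n))  ≡⟨ ℤ.+-assoc L S _ ⟨
  (L + S) + F (suc n) (suc n)  ≡⟨ cong₂ _+_ (cong (_+ S) (sumTo-triangle n F)) lastRow ⟩
  (R + S) + G (suc n)          ≡⟨ cong (_+ G (suc n)) (sumTo-+ n _ _) ⟨
  sumTo n (λ k → sumTo (n ∸ k) (λ l → F k (k +ℕ l)) + F k (suc n)) + G (suc n)
                               ≡⟨ cong (_+ G (suc n)) (sumTo-cong-≤ n extendRow) ⟨
  sumTo n G + G (suc n)        ∎
  where
  L = sumTo n (λ m → sumTo m (λ k → F k m))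
  S = sumTo n (λ k → F k (suc n))
  R = sumTo n (λ k → sumTo (n ∸ k) (λ l → F k (k +ℕ l)))
  G : ℕ → ℤ
  G k = sumTo (suc n ∸ k) (λ l → F k (k +ℕ l))
  lastRow : F (suc n) (suc n) ≡ G (suc n)
  lastRow = begin
    F (suc n) (suc n)       ≡⟨ cong (F (suc n)) (ℕ.+-identityʳ (suc n)) ⟨
    F (suc n) (suc n +ℕ 0)  ≡⟨ cong (λ t → sumTo t (λ l → F (suc n) (suc n +ℕ l))) (ℕ.n∸n≡0 n) ⟨
    G (suc n)               ∎
  extendRow : ∀ k → k ≤ℕ n → G k ≡ sumTo (n ∸ k) (λ l → F k (k +ℕ l)) + F k (suc n)
  extendRow k k≤n = begin
    G k ≡⟨ cong (λ t → sumTo t (λ l → F k (k +ℕ l))) (ℕ.+-∸-assoc 1 k≤n) ⟩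
    sumTo (n ∸ k) (λ l → F k (k +ℕ l)) + F k (k +ℕ suc (n ∸ k))
      ≡⟨ cong (λ t → sumTo (n ∸ k) (λ l → F k (k +ℕ l)) + F k t)
              (trans (ℕ.+-suc k (n ∸ k)) (cong suc (ℕ.m+[n∸m]≡n k≤n))) ⟩
    sumTo (n ∸ k) (λ l → F k (k +ℕ l)) + F k (suc n) ∎

≈-refl : ∀ {u} → u ≈ u
≈-refl _ = refl

⊛-cong : ∀ {u u' v v'} → u ≈ u' → v ≈ v' → (u ⊛ v) ≈ (u' ⊛ v')
⊛-cong u≈u' v≈v' n = sumTo-cong n (λ i → cong₂ _*_ (u≈u' i) (v≈v' (n ∸ i)))

⊛-congˡ : ∀ {u v v'} → v ≈ v' → (u ⊛ v) ≈ (u ⊛ v')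
⊛-congˡ {u} = ⊛-cong {u} ≈-refl

⊛-congʳ : ∀ {u u' v} → u ≈ u' → (u ⊛ v) ≈ (u' ⊛ v)
⊛-congʳ {v = v} u≈u' = ⊛-cong u≈u' (≈-refl {v})

⊛-comm : ∀ u v → (u ⊛ v) ≈ (v ⊛ u)
⊛-comm u v n = begin
  sumTo n (λ i → u i * v (n ∸ i))                ≡⟨ sumTo-reverse n _ ⟩
  sumTo n (λ i → u (n ∸ i) * v (n ∸ (n ∸ i)))
    ≡⟨ sumTo-cong-≤ n (λ i i≤n → trans (cong (λ t → u (n ∸ i) * v t) (ℕ.m∸[m∸n]≡n i≤n))
                                       (ℤ.*-comm (u (n ∸ i)) (v i))) ⟩
  sumTo n (λ i → v i * u (n ∸ i))                ∎

⊛-assoc : ∀ u v w → ((u ⊛ v) ⊛ w) ≈ (u ⊛ (v ⊛ w))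
⊛-assoc u v w n = begin
  sumTo n (λ i → sumTo i (λ j → u j * v (i ∸ j)) * w (n ∸ i))
    ≡⟨ sumTo-cong n (λ i → *-distribʳ-sumTo i (w (n ∸ i)) _) ⟩
  sumTo n (λ i → sumTo i (λ j → u j * v (i ∸ j) * w (n ∸ i)))
    ≡⟨ sumTo-triangle n (λ j i → u j * v (i ∸ j) * w (n ∸ i)) ⟩
  sumTo n (λ j → sumTo (n ∸ j) (λ l → u j * v (j +ℕ l ∸ j) * w (n ∸ (j +ℕ l))))
    ≡⟨ sumTo-cong n (λ j → sumTo-cong (n ∸ j) (λ l →
         trans (cong₂ (λ a b → u j * v a * w b) (ℕ.m+n∸m≡n j l) (sym (ℕ.∸-+-assoc n j l)))
               (ℤ.*-assoc (u j) (v l) (w (n ∸ j ∸ l))))) ⟩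
  sumTo n (λ j → sumTo (n ∸ j) (λ l → u j * (v l * w (n ∸ j ∸ l))))
    ≡⟨ sumTo-cong n (λ j → *-distribˡ-sumTo (n ∸ j) (u j) _) ⟨
  sumTo n (λ j → u j * sumTo (n ∸ j) (λ l → v l * w (n ∸ j ∸ l))) ∎

⊛-identityʳ : ∀ u → (u ⊛ One) ≈ u
⊛-identityʳ u zero    = ℤ.*-identityʳ (u 0)
⊛-identityʳ u (suc n) = begin
  sumTo n (λ i → u i * One (suc n ∸ i)) + u (suc n) * One (n ∸ n)
    ≡⟨ cong₂ _+_ (sumTo-≡0 n (λ i i≤n → trans (cong (λ t → u i * One t) (ℕ.+-∸-assoc 1 i≤n))
                                              (ℤ.*-zeroʳ (u i))))
                 (trans (cong (λ t → u (suc n) * One t) (ℕ.n∸n≡0 n)) (ℤ.*-identityʳ (u (suc n)))) ⟩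
  0ℤ + u (suc n) ≡⟨ ℤ.+-identityˡ (u (suc n)) ⟩
  u (suc n)      ∎

⊛-identityˡ : ∀ u → (One ⊛ u) ≈ u
⊛-identityˡ u n = trans (⊛-comm One u n) (⊛-identityʳ u n)

X⊛-shift : ∀ u n → (X ⊛ u) (suc n) ≡ u n
X⊛-shift u n = begin
  sumTo (suc n) (λ i → X i * u (suc n ∸ i))               ≡⟨ sumTo-sucˡ n _ ⟩
  0ℤ * u (suc n) + sumTo n (λ i → X (suc i) * u (n ∸ i))  ≡⟨ ℤ.+-identityˡ _ ⟩
  sumTo n (λ i → X (suc i) * u (n ∸ i))                   ≡⟨ sumTo-truncate 0 n z≤n (λ { (suc i) _ _ → refl }) ⟩
  1ℤ * u n                                                ≡⟨ ℤ.*-identityˡ (u n) ⟩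
  u n                                                     ∎

^^-cong : ∀ {u v} → u ≈ v → ∀ k → (u ^^ k) ≈ (v ^^ k)
^^-cong u≈v zero    = ≈-refl
^^-cong u≈v (suc k) = ⊛-cong u≈v (^^-cong u≈v k)

^^-+ : ∀ h m l → (h ^^ (m +ℕ l)) ≈ ((h ^^ m) ⊛ (h ^^ l))
^^-+ h zero    l n = sym (⊛-identityˡ (h ^^ l) n)
^^-+ h (suc m) l n = trans (⊛-congˡ {h} (^^-+ h m l) n) (sym (⊛-assoc h (h ^^ m) (h ^^ l) n))

^^-vanish : ∀ h → h 0 ≡ 0ℤ → ∀ k n → n <ℕ k → (h ^^ k) n ≡ 0ℤ
^^-vanish h h0 (suc k) n (s≤s n≤k) = sumTo-≡0 n λ
  { zero    _     → trans (cong (_* (h ^^ k) n) h0) (ℤ.*-zeroˡ ((h ^^ k) n))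
  ; (suc i) 1+i≤n → trans (cong (h (suc i) *_) (^^-vanish h h0 k (n ∸ suc i)
                            (ℕ.<-≤-trans (ℕ.∸-monoʳ-< (s≤s z≤n) 1+i≤n) n≤k)))
                          (ℤ.*-zeroʳ (h (suc i))) }

^^-diagonal : ∀ h → h 0 ≡ 0ℤ → h 1 ≡ 1ℤ → ∀ n → (h ^^ n) n ≡ 1ℤ
^^-diagonal h h0 h1 zero    = refl
^^-diagonal h h0 h1 (suc n) = begin
  sumTo (suc n) (λ i → h i * (h ^^ n) (suc n ∸ i)) ≡⟨ sumTo-sucˡ n _ ⟩
  h 0 * (h ^^ n) (suc n) + sumTo n (λ i → h (suc i) * (h ^^ n) (n ∸ i))
    ≡⟨ cong₂ _+_ (trans (cong (_* (h ^^ n) (suc n)) h0) (ℤ.*-zeroˡ ((h ^^ n) (suc n))))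
                 (sumTo-truncate 0 n z≤n (λ { (suc i) _ 1+i≤n →
                    trans (cong (h (suc (suc i)) *_) (^^-vanish h h0 n (n ∸ suc i) (ℕ.∸-monoʳ-< (s≤s z≤n) 1+i≤n)))
                          (ℤ.*-zeroʳ (h (suc (suc i)))) })) ⟩
  0ℤ + h 1 * (h ^^ n) n ≡⟨ ℤ.+-identityˡ (h 1 * (h ^^ n) n) ⟩
  h 1 * (h ^^ n) n      ≡⟨ cong₂ _*_ h1 (^^-diagonal h h0 h1 n) ⟩
  1ℤ                    ∎

X^^-aboveDiagonal : ∀ k n → k <ℕ n → (X ^^ k) n ≡ 0ℤ
X^^-aboveDiagonal zero    (suc n) _         = refl
X^^-aboveDiagonal (suc k) (suc n) (s≤s k<n) = trans (X⊛-shift (X ^^ k) n) (X^^-aboveDiagonal k n k<n)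

⊛^^-vanish : ∀ g h → h 0 ≡ 0ℤ → ∀ k n → n <ℕ k → (g ⊛ (h ^^ k)) n ≡ 0ℤ
⊛^^-vanish g h h0 k n n<k = sumTo-≡0 n (λ i _ →
  trans (cong (g i *_) (^^-vanish h h0 k (n ∸ i) (ℕ.≤-<-trans (ℕ.m∸n≤m n i) n<k))) (ℤ.*-zeroʳ (g i)))

compose-extend : ∀ p h → h 0 ≡ 0ℤ → ∀ n i → i ≤ℕ n → compose p h i ≡ sumTo n (λ k → p k * (h ^^ k) i)
compose-extend p h h0 n i i≤n = sym (sumTo-truncate i n i≤n (λ k i<k _ →
  trans (cong (p k *_) (^^-vanish h h0 k i i<k)) (ℤ.*-zeroʳ (p k))))

compose-congʳ : ∀ p {h h'} → h ≈ h' → compose p h ≈ compose p h'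
compose-congʳ p h≈h' n = sumTo-cong n (λ k → cong (p k *_) (^^-cong h≈h' k n))

compose-identityˡ : ∀ h → h 0 ≡ 0ℤ → compose X h ≈ h
compose-identityˡ h h0 zero    = sym h0
compose-identityˡ h h0 (suc n) = begin
  sumTo (suc n) (λ k → X k * (h ^^ k) (suc n))                     ≡⟨ sumTo-sucˡ n _ ⟩
  0ℤ * One (suc n) + sumTo n (λ k → X (suc k) * (h ^^ suc k) (suc n)) ≡⟨ ℤ.+-identityˡ _ ⟩
  sumTo n (λ k → X (suc k) * (h ^^ suc k) (suc n))  ≡⟨ sumTo-truncate 0 n z≤n (λ { (suc i) _ _ → refl }) ⟩
  1ℤ * (h ⊛ One) (suc n)                            ≡⟨ ℤ.*-identityˡ _ ⟩
  (h ⊛ One) (suc n)                                 ≡⟨ ⊛-identityʳ h (suc n) ⟩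
  h (suc n)                                         ∎

compose-identityʳ : ∀ p → compose p X ≈ p
compose-identityʳ p zero    = ℤ.*-identityʳ (p 0)
compose-identityʳ p (suc n) = begin
  sumTo n (λ k → p k * (X ^^ k) (suc n)) + p (suc n) * (X ^^ suc n) (suc n)
    ≡⟨ cong₂ _+_ (sumTo-≡0 n (λ k k≤n → trans (cong (p k *_) (X^^-aboveDiagonal k (suc n) (s≤s k≤n)))
                                              (ℤ.*-zeroʳ (p k))))
                 (trans (cong (p (suc n) *_) (^^-diagonal X refl refl (suc n))) (ℤ.*-identityʳ (p (suc n)))) ⟩
  0ℤ + p (suc n) ≡⟨ ℤ.+-identityˡ (p (suc n)) ⟩
  p (suc n)      ∎

compose-One : ∀ h → compose One h ≈ One
compose-One h n = begin
  sumTo n (λ k → One k * (h ^^ k) n) ≡⟨ sumTo-truncate 0 n z≤n (λ { (suc i) _ _ → refl }) ⟩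
  1ℤ * One n                          ≡⟨ ℤ.*-identityˡ (One n) ⟩
  One n                               ∎

compose-⊛ : ∀ p q h → h 0 ≡ 0ℤ → compose (p ⊛ q) h ≈ (compose p h ⊛ compose q h)
compose-⊛ p q h h0 n = trans expandLeft (sym expandRight)
  where
  H : ℕ → ℕ → ℤ
  H k i = (h ^^ k) i
  T : ℤ
  T = sumTo n (λ k → sumTo n (λ l → p k * q l * ((h ^^ k) ⊛ (h ^^ l)) n))
  expandLeft : compose (p ⊛ q) h n ≡ T
  expandLeft = begin
    sumTo n (λ m → sumTo m (λ k → p k * q (m ∸ k)) * H m n)
      ≡⟨ sumTo-cong n (λ m → *-distribʳ-sumTo m (H m n) _) ⟩
    sumTo n (λ m → sumTo m (λ k → p k * q (m ∸ k) * H m n))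
      ≡⟨ sumTo-triangle n (λ k m → p k * q (m ∸ k) * H m n) ⟩
    sumTo n (λ k → sumTo (n ∸ k) (λ l → p k * q (k +ℕ l ∸ k) * H (k +ℕ l) n))
      ≡⟨ sumTo-cong n (λ k → sumTo-cong (n ∸ k) (λ l → cong (λ t → p k * q t * H (k +ℕ l) n) (ℕ.m+n∸m≡n k l))) ⟩
    sumTo n (λ k → sumTo (n ∸ k) (λ l → p k * q l * H (k +ℕ l) n))
      ≡⟨ sumTo-cong-≤ n (λ k k≤n → sumTo-truncate (n ∸ k) n (ℕ.m∸n≤m n k) (λ l n-k<l _ →
           trans (cong (p k * q l *_) (^^-vanish h h0 (k +ℕ l) n
                    (subst (_<ℕ k +ℕ l) (ℕ.m+[n∸m]≡n k≤n) (ℕ.+-monoʳ-< k n-k<l))))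
                 (ℤ.*-zeroʳ (p k * q l)))) ⟨
    sumTo n (λ k → sumTo n (λ l → p k * q l * H (k +ℕ l) n))
      ≡⟨ sumTo-cong n (λ k → sumTo-cong n (λ l → cong (p k * q l *_) (^^-+ h k l n))) ⟩
    T ∎
  expandRight : (compose p h ⊛ compose q h) n ≡ T
  expandRight = begin
    sumTo n (λ i → compose p h i * compose q h (n ∸ i))
      ≡⟨ sumTo-cong-≤ n (λ i i≤n → cong₂ _*_ (compose-extend p h h0 n i i≤n)
                                             (compose-extend q h h0 n (n ∸ i) (ℕ.m∸n≤m n i))) ⟩
    sumTo n (λ i → sumTo n (λ k → p k * H k i) * sumTo n (λ l → q l * H l (n ∸ i)))
      ≡⟨ sumTo-cong n (λ i → trans (*-distribʳ-sumTo n _ _) (sumTo-cong n (λ k → *-distribˡ-sumTo n (p k * H k i) _))) ⟩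
    sumTo n (λ i → sumTo n (λ k → sumTo n (λ l → (p k * H k i) * (q l * H l (n ∸ i)))))
      ≡⟨ sumTo-comm n n _ ⟩
    sumTo n (λ k → sumTo n (λ i → sumTo n (λ l → (p k * H k i) * (q l * H l (n ∸ i)))))
      ≡⟨ sumTo-cong n (λ k → sumTo-comm n n _) ⟩
    sumTo n (λ k → sumTo n (λ l → sumTo n (λ i → (p k * H k i) * (q l * H l (n ∸ i)))))
      ≡⟨ sumTo-cong n (λ k → sumTo-cong n (λ l →
           trans (sumTo-cong n (λ i → *-interchange (p k) (H k i) (q l) (H l (n ∸ i))))
                 (sym (*-distribˡ-sumTo n (p k * q l) _)))) ⟩
    T ∎

compose-^^ : ∀ p h → h 0 ≡ 0ℤ → ∀ l → compose (p ^^ l) h ≈ (compose p h ^^ l)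
compose-^^ p h h0 zero    = compose-One h
compose-^^ p h h0 (suc l) n =
  trans (compose-⊛ p (p ^^ l) h h0 n) (⊛-congˡ {compose p h} (compose-^^ p h h0 l) n)

compose-assoc : ∀ p f h → f 0 ≡ 0ℤ → h 0 ≡ 0ℤ → compose (compose p f) h ≈ compose p (compose f h)
compose-assoc p f h f0 h0 n = begin
  sumTo n (λ k → compose p f k * (h ^^ k) n)
    ≡⟨ sumTo-cong-≤ n (λ k k≤n → cong (_* (h ^^ k) n) (compose-extend p f f0 n k k≤n)) ⟩
  sumTo n (λ k → sumTo n (λ l → p l * (f ^^ l) k) * (h ^^ k) n)
    ≡⟨ sumTo-cong n (λ k → *-distribʳ-sumTo n ((h ^^ k) n) _) ⟩
  sumTo n (λ k → sumTo n (λ l → p l * (f ^^ l) k * (h ^^ k) n))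
    ≡⟨ sumTo-comm n n _ ⟩
  sumTo n (λ l → sumTo n (λ k → p l * (f ^^ l) k * (h ^^ k) n))
    ≡⟨ sumTo-cong n (λ l → trans (sumTo-cong n (λ k → ℤ.*-assoc (p l) ((f ^^ l) k) ((h ^^ k) n)))
                                 (sym (*-distribˡ-sumTo n (p l) _))) ⟩
  sumTo n (λ l → p l * compose (f ^^ l) h n)
    ≡⟨ sumTo-cong n (λ l → cong (p l *_) (compose-^^ f h h0 l n)) ⟩
  sumTo n (λ l → p l * (compose f h ^^ l) n) ∎

-- Coefficient n of w ∘ h is w_n plus terms in w_0, …, w_{n-1}, because [x^n] h^n = 1.
compose-cancelʳ : ∀ h → h 0 ≡ 0ℤ → h 1 ≡ 1ℤ → ∀ w w' → compose w h ≈ compose w' h → w ≈ w'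
compose-cancelʳ h h0 h1 w w' eq n = upTo n n ℕ.≤-refl
  where
  upTo : ∀ n k → k ≤ℕ n → w k ≡ w' k
  upTo zero    zero z≤n = trans (sym (ℤ.*-identityʳ (w 0))) (trans (eq 0) (ℤ.*-identityʳ (w' 0)))
  upTo (suc n) k k≤1+n with ℕ.m≤n⇒m<n∨m≡n k≤1+n
  ... | inj₁ k<1+n = upTo n k (ℕ.≤-pred k<1+n)
  ... | inj₂ refl  = begin
      w (suc n)                         ≡⟨ ℤ.*-identityʳ (w (suc n)) ⟨
      w (suc n) * 1ℤ                    ≡⟨ cong (w (suc n) *_) diagonal ⟨
      w (suc n) * (h ^^ suc n) (suc n)  ≡⟨ +-cancelˡ (sumTo n (λ k → w k * (h ^^ k) (suc n))) _ _ lastTerm ⟩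
      w' (suc n) * (h ^^ suc n) (suc n) ≡⟨ cong (w' (suc n) *_) diagonal ⟩
      w' (suc n) * 1ℤ                   ≡⟨ ℤ.*-identityʳ (w' (suc n)) ⟩
      w' (suc n)                        ∎
    where
    diagonal = ^^-diagonal h h0 h1 (suc n)
    lastTerm = trans (eq (suc n)) (cong (_+ w' (suc n) * (h ^^ suc n) (suc n))
                 (sumTo-cong-≤ n (λ k k≤n → cong (_* (h ^^ k) (suc n)) (sym (upTo n k k≤n)))))

⊛-compose : ∀ f → f 0 ≡ 0ℤ → ∀ u p n → (u ⊛ compose p f) n ≡ sumTo n (λ l → p l * (u ⊛ (f ^^ l)) n)
⊛-compose f f0 u p n = begin
  sumTo n (λ i → u i * compose p f (n ∸ i))
    ≡⟨ sumTo-cong n (λ i → cong (u i *_) (compose-extend p f f0 n (n ∸ i) (ℕ.m∸n≤m n i))) ⟩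
  sumTo n (λ i → u i * sumTo n (λ l → p l * (f ^^ l) (n ∸ i)))
    ≡⟨ sumTo-cong n (λ i → *-distribˡ-sumTo n (u i) _) ⟩
  sumTo n (λ i → sumTo n (λ l → u i * (p l * (f ^^ l) (n ∸ i))))
    ≡⟨ sumTo-comm n n _ ⟩
  sumTo n (λ l → sumTo n (λ i → u i * (p l * (f ^^ l) (n ∸ i))))
    ≡⟨ sumTo-cong n (λ l → trans (sumTo-cong n (λ i → x∙yz≈y∙xz (u i) (p l) ((f ^^ l) (n ∸ i))))
                                 (sym (*-distribˡ-sumTo n (p l) _))) ⟩
  sumTo n (λ l → p l * (u ⊛ (f ^^ l)) n) ∎

-- The A-sequence of the Riordan array (g, f)

A-sequence-equation : ∀ f f̄ A → f 0 ≡ 0ℤ → f 1 ≡ 1ℤ → f̄ 0 ≡ 0ℤ →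
  compose f f̄ ≈ X → (A ⊛ f̄) ≈ X → f ≈ (X ⊛ compose A f)
A-sequence-equation f f̄ A f0 f1 f̄0 f∘f̄≈X A⊛f̄≈X =
  compose-cancelʳ f̄ f̄0 f̄1 f (X ⊛ compose A f) (λ n → trans (f∘f̄≈X n) (sym (composedRight n)))
  where
  f̄1 : f̄ 1 ≡ 1ℤ
  f̄1 = begin
    f̄ 1                          ≡⟨ ℤ.*-identityˡ (f̄ 1) ⟨
    1ℤ * f̄ 1                     ≡⟨ cong₂ _*_ f1 (⊛-identityʳ f̄ 1) ⟨
    f 1 * (f̄ ⊛ One) 1            ≡⟨ ℤ.+-identityˡ _ ⟨
    0ℤ + f 1 * (f̄ ⊛ One) 1       ≡⟨ cong (_+ f 1 * (f̄ ⊛ One) 1) (ℤ.*-zeroʳ (f 0)) ⟨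
    compose f f̄ 1                ≡⟨ f∘f̄≈X 1 ⟩
    1ℤ                           ∎
  composedRight : compose (X ⊛ compose A f) f̄ ≈ X
  composedRight n = begin
    compose (X ⊛ compose A f) f̄ n                     ≡⟨ compose-⊛ X (compose A f) f̄ f̄0 n ⟩
    (compose X f̄ ⊛ compose (compose A f) f̄) n        ≡⟨ ⊛-congʳ {v = compose (compose A f) f̄} (compose-identityˡ f̄ f̄0) n ⟩
    (f̄ ⊛ compose (compose A f) f̄) n                  ≡⟨ ⊛-congˡ {f̄} (compose-assoc A f f̄ f0 f̄0) n ⟩
    (f̄ ⊛ compose A (compose f f̄)) n                  ≡⟨ ⊛-congˡ {f̄} (compose-congʳ A f∘f̄≈X) n ⟩
    (f̄ ⊛ compose A X) n                               ≡⟨ ⊛-congˡ {f̄} (compose-identityʳ A) n ⟩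
    (f̄ ⊛ A) n                                         ≡⟨ ⊛-comm f̄ A n ⟩
    (A ⊛ f̄) n                                         ≡⟨ A⊛f̄≈X n ⟩
    X n                                               ∎

⊛^^suc-factorX : ∀ g f C → f ≈ (X ⊛ C) → ∀ m → (g ⊛ (f ^^ suc m)) ≈ (X ⊛ ((g ⊛ (f ^^ m)) ⊛ C))
⊛^^suc-factorX g f C f≈XC m n = begin
  (g ⊛ (f ⊛ F)) n              ≡⟨ ⊛-congˡ {g} (⊛-congʳ {v = F} f≈XC) n ⟩
  (g ⊛ ((X ⊛ C) ⊛ F)) n        ≡⟨ ⊛-congˡ {g} (⊛-assoc X C F) n ⟩
  (g ⊛ (X ⊛ (C ⊛ F))) n        ≡⟨ ⊛-assoc g X (C ⊛ F) n ⟨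
  ((g ⊛ X) ⊛ (C ⊛ F)) n        ≡⟨ ⊛-congʳ {v = C ⊛ F} (⊛-comm g X) n ⟩
  ((X ⊛ g) ⊛ (C ⊛ F)) n        ≡⟨ ⊛-assoc X g (C ⊛ F) n ⟩
  (X ⊛ (g ⊛ (C ⊛ F))) n        ≡⟨ ⊛-congˡ {X} (⊛-congˡ {g} (⊛-comm C F)) n ⟩
  (X ⊛ (g ⊛ (F ⊛ C))) n        ≡⟨ ⊛-congˡ {X} (λ i → sym (⊛-assoc g F C i)) n ⟩
  (X ⊛ ((g ⊛ F) ⊛ C)) n        ∎
  where F = f ^^ m

riordan-A-recurrence : ∀ g f A → f 0 ≡ 0ℤ → f ≈ (X ⊛ compose A f) → ∀ m j →
  (g ⊛ (f ^^ suc m)) (suc j) ≡ sumTo j (λ l → A l * (g ⊛ (f ^^ (m +ℕ l))) j)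
riordan-A-recurrence g f A f0 f≈X⊛A∘f m j = begin
  (g ⊛ (f ^^ suc m)) (suc j)                          ≡⟨ ⊛^^suc-factorX g f (compose A f) f≈X⊛A∘f m (suc j) ⟩
  (X ⊛ ((g ⊛ (f ^^ m)) ⊛ compose A f)) (suc j)       ≡⟨ X⊛-shift ((g ⊛ (f ^^ m)) ⊛ compose A f) j ⟩
  ((g ⊛ (f ^^ m)) ⊛ compose A f) j                    ≡⟨ ⊛-compose f f0 (g ⊛ (f ^^ m)) A j ⟩
  sumTo j (λ l → A l * ((g ⊛ (f ^^ m)) ⊛ (f ^^ l)) j)
    ≡⟨ sumTo-cong j (λ l → cong (A l *_)
         (trans (⊛-assoc g (f ^^ m) (f ^^ l) j) (⊛-congˡ {g} (λ i → sym (^^-+ f m l i)) j))) ⟩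
  sumTo j (λ l → A l * (g ⊛ (f ^^ (m +ℕ l))) j)       ∎

Identity-diagonal : ∀ n → Identity n n ≡ 1ℤ
Identity-diagonal n with n ≟ n
... | yes _  = refl
... | no n≢n = ⊥-elim (n≢n refl)

Identity-offDiagonal : ∀ n k → ¬ n ≡ k → Identity n k ≡ 0ℤ
Identity-offDiagonal n k n≢k with n ≟ k
... | yes n≡k = ⊥-elim (n≢k n≡k)
... | no _    = refl

apply-Identity : ∀ q → apply Identity q ≈ q
apply-Identity q zero    = trans (cong (_* q 0) (Identity-diagonal 0)) (ℤ.*-identityˡ (q 0))
apply-Identity q (suc n) = begin
  sumTo n (λ i → Identity (suc n) i * q i) + Identity (suc n) (suc n) * q (suc n)
    ≡⟨ cong₂ _+_ (sumTo-≡0 n (λ i i≤n → trans (cong (_* q i) (Identity-offDiagonal (suc n) i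
                                                    (λ 1+n≡i → ℕ.<-irrefl (sym 1+n≡i) (s≤s i≤n))))
                                              (ℤ.*-zeroˡ (q i))))
                 (trans (cong (_* q (suc n)) (Identity-diagonal (suc n))) (ℤ.*-identityˡ (q (suc n)))) ⟩
  0ℤ + q (suc n) ≡⟨ ℤ.+-identityˡ (q (suc n)) ⟩
  q (suc n)      ∎

apply-⊙ : ∀ L B → LowerTriangular B → ∀ q → apply L (apply B q) ≈ apply (L ⊙ B) q
apply-⊙ L B lowB q n = begin
  sumTo n (λ j → L n j * sumTo j (λ i → B j i * q i))
    ≡⟨ sumTo-cong-≤ n (λ j j≤n → cong (L n j *_) (sumTo-truncate j n j≤n (λ i j<i _ →
         trans (cong (_* q i) (lowB j i j<i)) (ℤ.*-zeroˡ (q i))))) ⟨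
  sumTo n (λ j → L n j * sumTo n (λ i → B j i * q i))
    ≡⟨ sumTo-cong n (λ j → *-distribˡ-sumTo n (L n j) _) ⟩
  sumTo n (λ j → sumTo n (λ i → L n j * (B j i * q i)))
    ≡⟨ sumTo-comm n n _ ⟩
  sumTo n (λ i → sumTo n (λ j → L n j * (B j i * q i)))
    ≡⟨ sumTo-cong n (λ i → trans (sumTo-cong n (λ j → sym (ℤ.*-assoc (L n j) (B j i) (q i))))
                                 (sym (*-distribʳ-sumTo n (q i) _))) ⟩
  sumTo n (λ i → (L ⊙ B) n i * q i) ∎

leftInverse-⊙-column : ∀ N M B k q → (∀ n i → (N ⊙ M) n i ≡ Identity n i) → LowerTriangular M →
  (∀ j → B j k ≡ apply M q j) → ∀ n → (N ⊙ B) n k ≡ q n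
leftInverse-⊙-column N M B k q NM≡I lowM column n = begin
  sumTo n (λ j → N n j * B j k)             ≡⟨ sumTo-cong n (λ j → cong (N n j *_) (column j)) ⟩
  apply N (apply M q) n                     ≡⟨ apply-⊙ N M lowM q n ⟩
  apply (N ⊙ M) q n                         ≡⟨ sumTo-cong n (λ i → cong (_* q i) (NM≡I n i)) ⟩
  apply Identity q n                        ≡⟨ apply-Identity q n ⟩
  q n                                       ∎

placedFrom-≥ : ∀ r A n → r ≤ℕ n → placedFrom r A n ≡ A (n ∸ r)
placedFrom-≥ r A n r≤n with r ≤? n
... | yes _   = refl
... | no  r≰n = ⊥-elim (r≰n r≤n)

placedFrom-< : ∀ r A n → n <ℕ r → placedFrom r A n ≡ 0ℤ
placedFrom-< r A n n<r with r ≤? n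
... | yes r≤n = ⊥-elim (ℕ.<⇒≱ n<r r≤n)
... | no  _   = refl

module _ (R : AlmostRiordan) where
  open AlmostRiordan R

  matrixOf-lowerTriangular : LowerTriangular (matrixOf R)
  matrixOf-lowerTriangular zero    (suc k) _         = refl
  matrixOf-lowerTriangular (suc n) (suc k) (s≤s n<k) = ⊛^^-vanish g f f0 k n n<k

  apply-matrixOf-placedFrom : ∀ A m j → apply (matrixOf R) (placedFrom (suc m) A) (suc j)
    ≡ sumTo j (λ l → A l * (g ⊛ (f ^^ (m +ℕ l))) j)
  apply-matrixOf-placedFrom A m j = begin
    sumTo (suc j) (λ i → matrixOf R (suc j) i * q i)
      ≡⟨ sumTo-sucˡ j _ ⟩
    a (suc j) * q 0 + sumTo j (λ i → (g ⊛ (f ^^ i)) j * q (suc i))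
      ≡⟨ cong (_+ sumTo j (λ i → (g ⊛ (f ^^ i)) j * q (suc i)))
              (trans (cong (a (suc j) *_) (placedFrom-< (suc m) A 0 (s≤s z≤n))) (ℤ.*-zeroʳ (a (suc j)))) ⟩
    0ℤ + sumTo j (λ i → (g ⊛ (f ^^ i)) j * q (suc i))
      ≡⟨ ℤ.+-identityˡ _ ⟩
    sumTo j (λ i → (g ⊛ (f ^^ i)) j * q (suc i))
      ≡⟨ sumTo-truncate j (m +ℕ j) (ℕ.m≤n+m j m) (λ i j<i _ →
           trans (cong (_* q (suc i)) (⊛^^-vanish g f f0 i j j<i)) (ℤ.*-zeroˡ (q (suc i)))) ⟨
    sumTo (m +ℕ j) (λ i → (g ⊛ (f ^^ i)) j * q (suc i))
      ≡⟨ sumTo-dropInitial m (m +ℕ j) _ (ℕ.m≤m+n m j) (λ i i<m →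
           trans (cong ((g ⊛ (f ^^ i)) j *_) (placedFrom-< (suc m) A (suc i) (s≤s i<m)))
                 (ℤ.*-zeroʳ ((g ⊛ (f ^^ i)) j))) ⟩
    sumTo (m +ℕ j ∸ m) (λ l → (g ⊛ (f ^^ (m +ℕ l))) j * q (suc (m +ℕ l)))
      ≡⟨ cong (λ t → sumTo t (λ l → (g ⊛ (f ^^ (m +ℕ l))) j * q (suc (m +ℕ l)))) (ℕ.m+n∸m≡n m j) ⟩
    sumTo j (λ l → (g ⊛ (f ^^ (m +ℕ l))) j * q (suc (m +ℕ l)))
      ≡⟨ sumTo-cong j (λ l → trans
           (cong ((g ⊛ (f ^^ (m +ℕ l))) j *_)
                 (trans (placedFrom-≥ (suc m) A (suc (m +ℕ l)) (s≤s (ℕ.m≤m+n m l))) (cong A (ℕ.m+n∸m≡n m l))))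
           (ℤ.*-comm ((g ⊛ (f ^^ (m +ℕ l))) j) (A l))) ⟩
    sumTo j (λ l → A l * (g ⊛ (f ^^ (m +ℕ l))) j) ∎
    where q = placedFrom (suc m) A

  dropTop-column-A : ∀ A → f ≈ (X ⊛ compose A f) → ∀ m j →
    dropTop (matrixOf R) j (suc (suc m)) ≡ apply (matrixOf R) (placedFrom (suc m) A) j
  dropTop-column-A A f≈X⊛A∘f m zero = begin
    (g ⊛ (f ^^ suc m)) 0   ≡⟨ ⊛^^-vanish g f f0 (suc m) 0 (s≤s z≤n) ⟩
    0ℤ                     ≡⟨ ℤ.*-zeroʳ (a 0) ⟨
    a 0 * 0ℤ               ≡⟨ cong (a 0 *_) (placedFrom-< (suc m) A 0 (s≤s z≤n)) ⟨
    a 0 * placedFrom (suc m) A 0 ∎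
  dropTop-column-A A f≈X⊛A∘f m (suc j) =
    trans (riordan-A-recurrence g f A f0 f≈X⊛A∘f m j) (sym (apply-matrixOf-placedFrom A m j))

mainTheorem10 : (R : AlmostRiordan) (N : Matrix) → IsInverse N (matrixOf R) →
    (fbar A : Series) → fbar 0 ≡ 0ℤ → compose (AlmostRiordan.f R) fbar ≈ X → (A ⊛ fbar) ≈ X →
    (∀ n → (N ⊙ dropTop (matrixOf R)) n 0 ≡ apply N (tilde (AlmostRiordan.a R)) n)
    × (∀ n → (N ⊙ dropTop (matrixOf R)) n 1 ≡ apply N (AlmostRiordan.g R) n)
    × (∀ m n → (N ⊙ dropTop (matrixOf R)) n (suc (suc m)) ≡ placedFrom (suc m) A n)
mainTheorem10 R N (_ , NM≡I , _) f̄ A f̄0 f∘f̄≈X A⊛f̄≈X = column₀ , column₁ , columnA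
  where
  open AlmostRiordan R
  column₀ : ∀ n → (N ⊙ dropTop (matrixOf R)) n 0 ≡ apply N (tilde a) n
  column₀ n = refl
  column₁ : ∀ n → (N ⊙ dropTop (matrixOf R)) n 1 ≡ apply N g n
  column₁ n = sumTo-cong n (λ j → cong (N n j *_) (⊛-identityʳ g j))
  columnA : ∀ m n → (N ⊙ dropTop (matrixOf R)) n (suc (suc m)) ≡ placedFrom (suc m) A n
  columnA m = leftInverse-⊙-column N (matrixOf R) (dropTop (matrixOf R)) (suc (suc m)) (placedFrom (suc m) A)
    NM≡I (matrixOf-lowerTriangular R)
    (dropTop-column-A R A (A-sequence-equation f f̄ A f0 f1 f̄0 f∘f̄≈X A⊛f̄≈X) m)
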